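{- Let $k\ge1$, $c\in\{0,\dots,k\}$, and let $\lambda$ be a partition contained in $R=(c^{k+1-c})$. Let $x_1,\dots,x_n$ be distinct cells of $\lambda$, $\mathfrak X_b=\{x_1,\dots,x_b\}$, and $1\le a\le n$. Then \[ w_{\lambda\setminus\mathfrak X_{a-1}}=w_{\lambda\setminus\mathfrak X_a}\,t_{\alpha,\beta}, \] where $\alpha$ and $\beta$ are the contents of the last cells of the West-North and North-West bounce paths, respectively, in $\lambda\setminus\mathfrak X_a$ starting at $x_a$. In particular, for a single cell $(i,j)$ of $\lambda$, $w_\lambda=w_{\lambda\setminus\{(i,j)\}}\,t_{ -i+1,j}$.
   Context: Affine symmetric group $W$: bijections $w:\mathbb Z\to\mathbb Z$ with $w(m+k+1)=w(m)+k+1$ and $\sum_{m=1}^{k+1}w(m)=\sum_{m=1}^{k+1}m$; for $r\in\{0,\dots,k\}$, $s_r$ exchanges $r+t(k+1)$ and $r+1+t(k+1)$ for all $t$; $s_a:=s_{a\bmod(k+1)}$; for $i\not\equiv j$ mod $k+1$, $t_{i,j}$ exchanges $i+t(k+1)$ and $j+t(k+1)$ for all $t$ and fixes other integers. Diagrams: cell $(p,q)$ in row $p\ge1$ (from top), column $q\ge1$ (from left), content $q-p$, residue $(q-p)\bmod(k+1)$. For a set $\mathcal D$ of cells, $w_{\mathcal D}=s_{r_1}\cdots s_{r_m}\in W$ where $r_1,\dots,r_m$ are the residues read starting in the bottom row, each row right to left, rows bottom to top. $\lambda\setminus X$ removes the cells of $X$. Bounce paths of a cell $x$ in $\lambda\setminus\mathfrak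 X$. West-North: start at $x$ heading West; repeatedly look at the next cell $y$ in the current direction; if heading West and $y\notin\lambda$ (i.e. $y$ is in column $0$) the path ends at the current cell (in column 1); if heading North and $y\notin\lambda$ (i.e. $y$ is in row $0$) the path ends at $y$ (in row $0$, just outside $\lambda$); otherwise move to $y$ and, if $y\in\mathfrak X$, switch direction between West and North. North-West: the same rule but starting with direction North. (For $\mathfrak X=\{(i,j)\}$ these end at contents $1-i$ and $j$ respectively.) -}

module Defs where

open import Data.Nat as ℕ using (ℕ; zero; suc)
import Data.Nat.Properties as ℕP
open import Data.Integer as ℤ using (ℤ; +_; _-_; _%ℕ_)
open import Data.Bool using (Bool; true; false; if_then_else_)
open import Data.Product using (_×_; _,_)
open import Data.Product.Properties using (≡-dec)
open import Data.List using (List; []; _∷_; length; lookup; reverse; upTo)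
open import Data.List.Relation.Unary.All using (All)
open import Data.List.Relation.Unary.Linked using (Linked)
open import Data.Fin using (Fin; toℕ)
open import Relation.Nullary using (Dec; yes; no; does)
open import Relation.Binary.PropositionalEquality using (_≡_)
import Data.List.Membership.DecPropositional as DecMem

-- Cells (p , q) : row p ≥ 1 (from top), column q ≥ 1 (from left).

Cell : Set
Cell = ℕ × ℕ

_≟c_ : (x y : Cell) → Dec (x ≡ y)
_≟c_ = ≡-dec ℕ._≟_ ℕ._≟_

open DecMem _≟c_ public using (_∈?_)

_∈ᵇ_ : Cell → List Cell → Bool
x ∈ᵇ X = does (x ∈? X)

content : Cell → ℤ
content (p , q) = + q - + p

IsPartition : List ℕ → Set
IsPartition la = Linked ℕ._≥_ la × All (λ r → 1 ℕ.≤ r) la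

InRect : ℕ → ℕ → List ℕ → Set
InRect c h la = length la ℕ.≤ h × All (λ r → r ℕ.≤ c) la

row : List ℕ → ℕ → ℕ
row []       _             = 0
row (r ∷ la) zero          = 0
row (r ∷ la) (suc zero)    = r
row (r ∷ la) (suc (suc p)) = row la (suc p)

_∈λ_ : Cell → List ℕ → Set
(p , q) ∈λ la = (1 ℕ.≤ p) × (p ℕ.≤ length la) × (1 ℕ.≤ q) × (q ℕ.≤ row la p)

-- The affine symmetric group, acting on ℤ (window size k+1).
-- Elements are represented by their action; products compose as
-- (u v)(m) = u (v m).

sAct : (k : ℕ) → ℕ → ℤ → ℤ
sAct k r m with (m %ℕ suc k) ℕ.≟ (r ℕ.% suc k)
... | yes _ = m ℤ.+ ℤ.1ℤ
... | no _ with (m %ℕ suc k) ℕ.≟ (suc r ℕ.% suc k)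
...   | yes _ = m - ℤ.1ℤ
...   | no _  = m

-- transposition t_{i,j} : exchanges i + t(k+1) and j + t(k+1) for all t
-- (meaningful when i ≢ j mod k+1)
tAct : (k : ℕ) → ℤ → ℤ → ℤ → ℤ
tAct k i j m with (m %ℕ suc k) ℕ.≟ (i %ℕ suc k)
... | yes _ = m ℤ.+ (j - i)
... | no _ with (m %ℕ suc k) ℕ.≟ (j %ℕ suc k)
...   | yes _ = m ℤ.+ (i - j)
...   | no _  = m

residue : (k : ℕ) → Cell → ℕ
residue k x = content x %ℕ suc k

rowCells : ℕ → ℕ → List Cell → List Cell
rowCells p zero    X = []
rowCells p (suc q) X =
  if (p , suc q) ∈ᵇ X then rowCells p q X else (p , suc q) ∷ rowCells p q X

cellsFrom : List ℕ → ℕ → List Cell → List Cell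
cellsFrom la zero    X = []
cellsFrom la (suc p) X = rowCells (suc p) (row la (suc p)) X Data.List.++ cellsFrom la p X

-- reading word of la \ X: bottom row first, each row right to left
readingCells : List ℕ → List Cell → List Cell
readingCells la X = cellsFrom la (length la) X

wordAct : (k : ℕ) → List ℕ → ℤ → ℤ
wordAct k []       m = m
wordAct k (r ∷ rs) m = sAct k r (wordAct k rs m)

wAct : (k : ℕ) → List ℕ → List Cell → ℤ → ℤ
wAct k la X = wordAct k (Data.List.map (residue k) (readingCells la X))

-- Bounce paths in la \ X, returning the content of the last cell.
-- (Starting from a cell of la, moving West/North never leaves la
-- before reaching column 0 / row 0.)

data Dir : Set where
  west north : Dir

switch : Dir → Dir
switch west  = north
switch north = west

bounce : List Cell → Dir → ℕ → ℕ → ℤ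
-- heading West; next cell would be in column 0: end at current cell (column 1)
bounce X west  p (suc zero)    = content (p , 1)
bounce X west  p (suc (suc q)) =
  if (p , suc q) ∈ᵇ X then bounce X north p (suc q) else bounce X west p (suc q)
-- heading North; next cell is in row 0: end at that cell (0 , q)
bounce X north (suc zero)    q = content (0 , q)
bounce X north (suc (suc p)) q =
  if (suc p , q) ∈ᵇ X then bounce X west (suc p) q else bounce X north (suc p) q
-- degenerate (not a cell); never reached from cells of a diagram
bounce X west  p zero = content (p , 0)
bounce X north zero q = content (0 , q)

bounceWN : List Cell → Cell → ℤ
bounceWN X (p , q) = bounce X west p q

bounceNW : List Cell → Cell → ℤ
bounceNW X (p , q) = bounce X north p q

module Submission where

-- Removing x_a from λ ∖ X_{a-1} deletes one letter s_ρ (ρ the content of x_a) from the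
-- reading word: w_{λ∖X_{a-1}} = u s_ρ v while w_{λ∖X_a} = u v. Conjugating a reflection,
-- s_ρ v = v t_{α,β} with α = v⁻¹ ρ and β = v⁻¹ (ρ + 1), and v⁻¹ applies the letters of v
-- one at a time in reading order. Inside the rectangle (c^{k+1-c}) the content of a cell is
-- determined by its residue, so the letter of a cell y moves the tracked value only when y
-- is the next cell of a bounce path: ρ travels along the West-North path and ρ + 1 along
-- the North-West path, ending at α and β.

open import Defs
open import Data.Bool using (true; false; if_then_else_)
open import Data.Fin using (Fin; toℕ; suc)
open import Data.Integer as ℤ using (ℤ; +_; -[1+_]; _+_; _-_; _*_; -_; _%ℕ_; _/ℕ_; 0ℤ; 1ℤ)
import Data.Integer.Properties as ℤ
open import Data.Integer.DivMod using (a≡a%ℕn+[a/ℕn]*n; n%ℕd<d)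
open import Data.Integer.Tactic.RingSolver using (solve-∀)
open import Data.List using (List; []; _∷_; _++_; _∷ʳ_; map; reverse; length; lookup; take)
import Data.List.Properties as List
open import Data.List.Membership.Propositional using (_∉_)
open import Data.List.Membership.Propositional.Properties using (∈-++⁻; ∈-++⁺ˡ; ∈-++⁺ʳ; ∈-lookup)
open import Data.List.Relation.Unary.All as All using (All; []; _∷_)
open import Data.List.Relation.Unary.All.Properties using (++⁺)
open import Data.List.Relation.Unary.AllPairs using (_∷_)
open import Data.List.Relation.Unary.Any using (here; there)
open import Data.List.Relation.Unary.Linked using (Linked; _∷_)
open import Data.List.Relation.Unary.Unique.Propositional using (Unique)
open import Data.Nat as ℕ using (ℕ; zero; suc; _≤_; _<_; _∸_; z≤n; s≤s)
import Data.Nat.DivMod as ℕ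
import Data.Nat.Properties as ℕ
open import Data.Product using (∃; _×_; _,_; proj₁; proj₂)
open import Data.Sum using (_⊎_; inj₁; inj₂; [_,_]′)
open import Function using (_∘_; flip)
open import Relation.Nullary using (¬_; yes; no; contradiction)
open import Relation.Nullary.Decidable using (dec-true; dec-false)
open import Relation.Binary.PropositionalEquality
open ≡-Reasoning

-- Congruence modulo k + 1

module _ (k : ℕ) where

  private
    K : ℕ
    K = suc k

  infix 4 _≡ₖ_

  _≡ₖ_ : ℤ → ℤ → Set
  a ≡ₖ b = a %ℕ K ≡ b %ℕ K

  multiple-of-K-below-K : ∀ {d} z → d < K → + d ≡ z * + K → d ≡ 0
  multiple-of-K-below-K (+ zero)  _   eq = ℤ.+-injective eq
  multiple-of-K-below-K (+ suc n) d<K eq =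
    contradiction (ℕ.≤-trans (ℕ.m≤m+n K (n ℕ.* K)) (ℕ.≤-reflexive (sym (ℤ.+-injective eq)))) (ℕ.<⇒≱ d<K)
  multiple-of-K-below-K -[1+ n ]  _   ()

  remainder-unique-≤ : ∀ {r r′} q q′ → r ≤ r′ → r′ < K → + r + q * + K ≡ + r′ + q′ * + K → r ≡ r′
  remainder-unique-≤ {r} {r′} q q′ r≤r′ r′<K eq with ℕ.m≤n⇒∃[o]m+o≡n r≤r′
  ... | d , r+d≡r′ = trans (sym (ℕ.+-identityʳ r)) (trans (cong (r ℕ.+_) (sym d≡0)) r+d≡r′)
    where
    d≡0 : d ≡ 0
    d≡0 = multiple-of-K-below-K (q - q′) (ℕ.≤-<-trans (ℕ.m≤n+m d r) (subst (_< K) (sym r+d≡r′) r′<K)) (begin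
      + d                                  ≡⟨ isolate (+ r) (+ d) (q′ * + K) ⟩
      (+ r + + d + q′ * + K) - (+ r + q′ * + K) ≡⟨ cong (λ t → t + q′ * + K - (+ r + q′ * + K)) (sym (ℤ.pos-+ r d)) ⟩
      (+ (r ℕ.+ d) + q′ * + K) - (+ r + q′ * + K) ≡⟨ cong (λ t → + t + q′ * + K - (+ r + q′ * + K)) r+d≡r′ ⟩
      (+ r′ + q′ * + K) - (+ r + q′ * + K)  ≡⟨ cong (_- (+ r + q′ * + K)) (sym eq) ⟩
      (+ r + q * + K) - (+ r + q′ * + K)    ≡⟨ difference (+ r) q q′ (+ K) ⟩
      (q - q′) * + K                        ∎)
      where
      isolate : ∀ a b c → b ≡ (a + b + c) - (a + c)
      isolate = solve-∀
      difference : ∀ a x y c → (a + x * c) - (a + y * c) ≡ (x - y) * c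
      difference = solve-∀

  remainder-unique : ∀ {r r′} q q′ → r < K → r′ < K → + r + q * + K ≡ + r′ + q′ * + K → r ≡ r′
  remainder-unique {r} {r′} q q′ r<K r′<K eq with ℕ.≤-total r r′
  ... | inj₁ r≤r′ = remainder-unique-≤ q q′ r≤r′ r′<K eq
  ... | inj₂ r′≤r = sym (remainder-unique-≤ q′ q r′≤r r<K (sym eq))

  %ℕ-unique : ∀ {y r} q → r < K → y ≡ + r + q * + K → y %ℕ K ≡ r
  %ℕ-unique {y} q r<K y≡ = remainder-unique (y /ℕ K) q (n%ℕd<d y K) r<K
    (trans (sym (a≡a%ℕn+[a/ℕn]*n y K)) y≡)

  +*K-≡ₖ : ∀ z q → z + q * + K ≡ₖ z
  +*K-≡ₖ z q = %ℕ-unique (z /ℕ K + q) (n%ℕd<d z K) (begin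
    z + q * + K                               ≡⟨ cong (_+ q * + K) (a≡a%ℕn+[a/ℕn]*n z K) ⟩
    + (z %ℕ K) + (z /ℕ K) * + K + q * + K     ≡⟨ regroup (+ (z %ℕ K)) (z /ℕ K) q (+ K) ⟩
    + (z %ℕ K) + (z /ℕ K + q) * + K           ∎)
    where
    regroup : ∀ r a b c → r + a * c + b * c ≡ r + (a + b) * c
    regroup = solve-∀

  ≡ₖ⇒≡+*K : ∀ a b → a ≡ₖ b → ∃ λ q → a ≡ b + q * + K
  ≡ₖ⇒≡+*K a b a≡ₖb = a /ℕ K - b /ℕ K , (begin
    a                                           ≡⟨ a≡a%ℕn+[a/ℕn]*n a K ⟩
    + (a %ℕ K) + (a /ℕ K) * + K                 ≡⟨ cong (λ r → + r + (a /ℕ K) * + K) a≡ₖb ⟩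
    + (b %ℕ K) + (a /ℕ K) * + K                 ≡⟨ regroup (+ (b %ℕ K)) (a /ℕ K) (b /ℕ K) (+ K) ⟩
    + (b %ℕ K) + (b /ℕ K) * + K + (a /ℕ K - b /ℕ K) * + K
                                                ≡⟨ cong (_+ (a /ℕ K - b /ℕ K) * + K) (a≡a%ℕn+[a/ℕn]*n b K) ⟨
    b + (a /ℕ K - b /ℕ K) * + K                 ∎)
    where
    regroup : ∀ r x y c → r + x * c ≡ r + y * c + (x - y) * c
    regroup = solve-∀

  ≡ₖ-+ʳ : ∀ a b z → a ≡ₖ b → a + z ≡ₖ b + z
  ≡ₖ-+ʳ a b z a≡ₖb with ≡ₖ⇒≡+*K a b a≡ₖb
  ... | q , a≡ = begin
    (a + z) %ℕ K               ≡⟨ cong (λ t → (t + z) %ℕ K) a≡ ⟩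
    (b + q * + K + z) %ℕ K     ≡⟨ cong (_%ℕ K) (swap b (q * + K) z) ⟩
    (b + z + q * + K) %ℕ K     ≡⟨ +*K-≡ₖ (b + z) q ⟩
    (b + z) %ℕ K               ∎
    where
    swap : ∀ x y w → x + y + w ≡ x + w + y
    swap = solve-∀

  %ℕ-≡ₖ : ∀ z → + (z %ℕ K) ≡ₖ z
  %ℕ-≡ₖ z = ℕ.m<n⇒m%n≡m (n%ℕd<d z K)

  ≡ₖ-+-cancelʳ : ∀ a b z → a + z ≡ₖ b + z → a ≡ₖ b
  ≡ₖ-+-cancelʳ a b z eq =
    subst₂ _≡ₖ_ (cancel a z) (cancel b z) (≡ₖ-+ʳ (a + z) (b + z) (- z) eq)
    where
    cancel : ∀ x y → x + y + - y ≡ x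
    cancel = solve-∀

  window-injective : ∀ lo {u u′} → u < K → u′ < K → lo + + u ≡ₖ lo + + u′ → u ≡ u′
  window-injective lo {u} {u′} u<K u′<K eq = begin
    u             ≡⟨ sym (ℕ.m<n⇒m%n≡m u<K) ⟩
    u ℕ.% K       ≡⟨ ≡ₖ-+-cancelʳ (+ u) (+ u′) lo (subst₂ _≡ₖ_ (ℤ.+-comm lo (+ u)) (ℤ.+-comm lo (+ u′)) eq) ⟩
    u′ ℕ.% K      ≡⟨ ℕ.m<n⇒m%n≡m u′<K ⟩
    u′            ∎

  +1-≢ₖ : 1 ≤ k → ∀ z → ¬ (z + 1ℤ ≡ₖ z)
  +1-≢ₖ (s≤s z≤n) z eq with ≡ₖ-+-cancelʳ 1ℤ 0ℤ z (subst₂ _≡ₖ_ (ℤ.+-comm z 1ℤ) (sym (ℤ.+-identityˡ z)) eq)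
  ... | ()

  +suc-%ℕ-≡ₖ : ∀ ρ → + suc (ρ %ℕ K) ≡ₖ ρ + 1ℤ
  +suc-%ℕ-≡ₖ ρ = subst (_≡ₖ ρ + 1ℤ) (ℤ.+-comm (+ (ρ %ℕ K)) 1ℤ) (≡ₖ-+ʳ (+ (ρ %ℕ K)) ρ 1ℤ (%ℕ-≡ₖ ρ))

  -- Simple reflections and words

  sAct-≡ₖ : ∀ r z → z ≡ₖ + r → sAct k r z ≡ z + 1ℤ
  sAct-≡ₖ r z z≡r with z %ℕ K ℕ.≟ r ℕ.% K
  ... | yes _   = refl
  ... | no z≢r = contradiction z≡r z≢r

  sAct-≡ₖ-suc : ∀ r z → ¬ z ≡ₖ + r → z ≡ₖ + suc r → sAct k r z ≡ z - 1ℤ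
  sAct-≡ₖ-suc r z z≢r z≡r+1 with z %ℕ K ℕ.≟ r ℕ.% K
  ... | yes z≡r = contradiction z≡r z≢r
  ... | no _ with z %ℕ K ℕ.≟ suc r ℕ.% K
  ...   | yes _      = refl
  ...   | no z≢r+1 = contradiction z≡r+1 z≢r+1

  sAct-≢ₖ : ∀ r z → ¬ z ≡ₖ + r → ¬ z ≡ₖ + suc r → sAct k r z ≡ z
  sAct-≢ₖ r z z≢r z≢r+1 with z %ℕ K ℕ.≟ r ℕ.% K
  ... | yes z≡r = contradiction z≡r z≢r
  ... | no _ with z %ℕ K ℕ.≟ suc r ℕ.% K
  ...   | yes z≡r+1 = contradiction z≡r+1 z≢r+1
  ...   | no _      = refl

  +suc≡+1 : ∀ r → + suc r ≡ + r + 1ℤ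
  +suc≡+1 r = ℤ.+-comm 1ℤ (+ r)

  ≡ₖ-+suc⇒≢ₖ : 1 ≤ k → ∀ r z → z ≡ₖ + suc r → ¬ z ≡ₖ + r
  ≡ₖ-+suc⇒≢ₖ k≥1 r z z≡r+1 z≡r =
    +1-≢ₖ k≥1 (+ r) (trans (cong (_%ℕ K) (sym (+suc≡+1 r))) (trans (sym z≡r+1) z≡r))

  sAct-involutive : 1 ≤ k → ∀ r z → sAct k r (sAct k r z) ≡ z
  sAct-involutive k≥1 r z with z %ℕ K ℕ.≟ r ℕ.% K
  ... | yes z≡r = begin
    sAct k r (z + 1ℤ) ≡⟨ sAct-≡ₖ-suc r (z + 1ℤ) (≡ₖ-+suc⇒≢ₖ k≥1 r (z + 1ℤ) z+1≡r+1) z+1≡r+1 ⟩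
    z + 1ℤ - 1ℤ       ≡⟨ cancel z ⟩
    z                 ∎
    where
    z+1≡r+1 : z + 1ℤ ≡ₖ + suc r
    z+1≡r+1 = trans (≡ₖ-+ʳ z (+ r) 1ℤ z≡r) (cong (_%ℕ K) (sym (+suc≡+1 r)))
    cancel : ∀ x → x + 1ℤ - 1ℤ ≡ x
    cancel = solve-∀
  ... | no z≢r with z %ℕ K ℕ.≟ suc r ℕ.% K
  ...   | yes z≡r+1 = begin
    sAct k r (z - 1ℤ) ≡⟨ sAct-≡ₖ r (z - 1ℤ) (≡ₖ-+ʳ z (+ suc r) (- 1ℤ) z≡r+1) ⟩
    z - 1ℤ + 1ℤ       ≡⟨ cancel z ⟩
    z                 ∎
    where
    cancel : ∀ x → x - 1ℤ + 1ℤ ≡ x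
    cancel = solve-∀
  ...   | no z≢r+1 = sAct-≢ₖ r z z≢r z≢r+1

  Periodic : (ℤ → ℤ) → Set
  Periodic f = ∀ z q → f (z + q * + K) ≡ f z + q * + K

  periodic-≡ₖ : ∀ f → Periodic f → ∀ a b → a ≡ₖ b → f a ≡ₖ f b
  periodic-≡ₖ f f-periodic a b a≡b with ≡ₖ⇒≡+*K a b a≡b
  ... | q , a≡ = begin
    f a %ℕ K                 ≡⟨ cong (λ t → f t %ℕ K) a≡ ⟩
    f (b + q * + K) %ℕ K     ≡⟨ cong (_%ℕ K) (f-periodic b q) ⟩
    (f b + q * + K) %ℕ K     ≡⟨ +*K-≡ₖ (f b) q ⟩
    f b %ℕ K                 ∎

  sAct-periodic : ∀ r → Periodic (sAct k r)
  sAct-periodic r z q with z %ℕ K ℕ.≟ r ℕ.% K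
  ... | yes z≡r = trans (sAct-≡ₖ r (z + q * + K) (trans (+*K-≡ₖ z q) z≡r)) (swap z (q * + K) 1ℤ)
    where
    swap : ∀ x y w → x + y + w ≡ x + w + y
    swap = solve-∀
  ... | no z≢r with z %ℕ K ℕ.≟ suc r ℕ.% K
  ...   | yes z≡r+1 = trans (sAct-≡ₖ-suc r (z + q * + K) (z≢r ∘ trans (sym (+*K-≡ₖ z q))) (trans (+*K-≡ₖ z q) z≡r+1))
                            (swap z (q * + K) 1ℤ)
    where
    swap : ∀ x y w → x + y - w ≡ x - w + y
    swap = solve-∀
  ...   | no z≢r+1 = sAct-≢ₖ r (z + q * + K) (z≢r ∘ trans (sym (+*K-≡ₖ z q))) (z≢r+1 ∘ trans (sym (+*K-≡ₖ z q)))

  sAct-%ℕ-≡ₖ : ∀ ρ z → z ≡ₖ ρ → sAct k (ρ %ℕ K) z ≡ z + 1ℤ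
  sAct-%ℕ-≡ₖ ρ z z≡ρ = sAct-≡ₖ (ρ %ℕ K) z (trans z≡ρ (sym (%ℕ-≡ₖ ρ)))

  sAct-%ℕ-≡ₖ-+1 : 1 ≤ k → ∀ ρ z → z ≡ₖ ρ + 1ℤ → sAct k (ρ %ℕ K) z ≡ z - 1ℤ
  sAct-%ℕ-≡ₖ-+1 k≥1 ρ z z≡ρ+1 = sAct-≡ₖ-suc (ρ %ℕ K) z (≡ₖ-+suc⇒≢ₖ k≥1 (ρ %ℕ K) z z≡r+1) z≡r+1
    where
    z≡r+1 : z ≡ₖ + suc (ρ %ℕ K)
    z≡r+1 = trans z≡ρ+1 (sym (+suc-%ℕ-≡ₖ ρ))

  sAct-%ℕ-≢ₖ : ∀ ρ z → ¬ z ≡ₖ ρ → ¬ z ≡ₖ ρ + 1ℤ → sAct k (ρ %ℕ K) z ≡ z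
  sAct-%ℕ-≢ₖ ρ z z≢ρ z≢ρ+1 = sAct-≢ₖ (ρ %ℕ K) z (z≢ρ ∘ flip trans (%ℕ-≡ₖ ρ)) (z≢ρ+1 ∘ flip trans (+suc-%ℕ-≡ₖ ρ))

  wordAct-++ : ∀ rs ss m → wordAct k (rs ++ ss) m ≡ wordAct k rs (wordAct k ss m)
  wordAct-++ []       ss m = refl
  wordAct-++ (r ∷ rs) ss m = cong (sAct k r) (wordAct-++ rs ss m)

  wordAct-periodic : ∀ rs → Periodic (wordAct k rs)
  wordAct-periodic []       z q = refl
  wordAct-periodic (r ∷ rs) z q =
    trans (cong (sAct k r) (wordAct-periodic rs z q)) (sAct-periodic r (wordAct k rs z) q)

  wordAct-reverse-inverseˡ : 1 ≤ k → ∀ rs m → wordAct k (reverse rs) (wordAct k rs m) ≡ m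
  wordAct-reverse-inverseˡ k≥1 []       m = refl
  wordAct-reverse-inverseˡ k≥1 (r ∷ rs) m = begin
    wordAct k (reverse (r ∷ rs)) (sAct k r (wordAct k rs m))
      ≡⟨ cong (λ l → wordAct k l (sAct k r (wordAct k rs m))) (List.unfold-reverse r rs) ⟩
    wordAct k (reverse rs ∷ʳ r) (sAct k r (wordAct k rs m))
      ≡⟨ wordAct-++ (reverse rs) (r ∷ []) _ ⟩
    wordAct k (reverse rs) (sAct k r (sAct k r (wordAct k rs m)))
      ≡⟨ cong (wordAct k (reverse rs)) (sAct-involutive k≥1 r (wordAct k rs m)) ⟩
    wordAct k (reverse rs) (wordAct k rs m)
      ≡⟨ wordAct-reverse-inverseˡ k≥1 rs m ⟩
    m ∎

  wordAct-reverse-inverseʳ : 1 ≤ k → ∀ rs m → wordAct k rs (wordAct k (reverse rs) m) ≡ m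
  wordAct-reverse-inverseʳ k≥1 rs m =
    trans (cong (λ l → wordAct k l (wordAct k (reverse rs) m)) (sym (List.reverse-involutive rs)))
          (wordAct-reverse-inverseˡ k≥1 (reverse rs) m)

  module _ (k≥1 : 1 ≤ k) (f g : ℤ → ℤ) (f-periodic : Periodic f) (g-periodic : Periodic g)
           (f∘g : ∀ z → f (g z) ≡ z) (g∘f : ∀ z → g (f z) ≡ z) (ρ : ℤ) where

    preimages-≢ₖ : ¬ g ρ ≡ₖ g (ρ + 1ℤ)
    preimages-≢ₖ gρ≡gρ+1 = +1-≢ₖ k≥1 ρ (subst₂ _≡ₖ_ (f∘g (ρ + 1ℤ)) (f∘g ρ)
      (periodic-≡ₖ f f-periodic (g (ρ + 1ℤ)) (g ρ) (sym gρ≡gρ+1)))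

    private
      f-shift : ∀ m a b → m ≡ₖ a → f (m + (b - a)) ≡ f m + (f b - f a)
      f-shift m a b m≡a with ≡ₖ⇒≡+*K m a m≡a
      ... | q , refl = begin
        f (a + q * + K + (b - a))     ≡⟨ cong f (move a b (q * + K)) ⟩
        f (b + q * + K)               ≡⟨ f-periodic b q ⟩
        f b + q * + K                 ≡⟨ move (f a) (f b) (q * + K) ⟨
        f a + q * + K + (f b - f a)   ≡⟨ cong (_+ (f b - f a)) (f-periodic a q) ⟨
        f (a + q * + K) + (f b - f a) ∎
        where
        move : ∀ x y z → x + z + (y - x) ≡ y + z
        move = solve-∀

      push-forward : ∀ {m} z → m ≡ₖ g z → f m ≡ₖ z
      push-forward {m} z m≡gz = subst (f m ≡ₖ_) (f∘g z) (periodic-≡ₖ f f-periodic m (g z) m≡gz)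

    reflection-conjugate : ∀ m → sAct k (ρ %ℕ K) (f m) ≡ f (tAct k (g ρ) (g (ρ + 1ℤ)) m)
    reflection-conjugate m with m %ℕ K ℕ.≟ g ρ %ℕ K
    ... | yes m≡α = begin
      sAct k (ρ %ℕ K) (f m)             ≡⟨ sAct-%ℕ-≡ₖ ρ (f m) (push-forward ρ m≡α) ⟩
      f m + 1ℤ                          ≡⟨ cong (λ x → f m + x) (step ρ) ⟨
      f m + ((ρ + 1ℤ) - ρ)              ≡⟨ cong₂ (λ x y → f m + (x - y)) (f∘g (ρ + 1ℤ)) (f∘g ρ) ⟨
      f m + (f (g (ρ + 1ℤ)) - f (g ρ))  ≡⟨ f-shift m (g ρ) (g (ρ + 1ℤ)) m≡α ⟨
      f (m + (g (ρ + 1ℤ) - g ρ))        ∎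
      where
      step : ∀ x → (x + 1ℤ) - x ≡ 1ℤ
      step = solve-∀
    ... | no m≢α with m %ℕ K ℕ.≟ g (ρ + 1ℤ) %ℕ K
    ...   | yes m≡β = begin
      sAct k (ρ %ℕ K) (f m)             ≡⟨ sAct-%ℕ-≡ₖ-+1 k≥1 ρ (f m) (push-forward (ρ + 1ℤ) m≡β) ⟩
      f m - 1ℤ                          ≡⟨ cong (λ x → f m + x) (step ρ) ⟨
      f m + (ρ - (ρ + 1ℤ))              ≡⟨ cong₂ (λ x y → f m + (x - y)) (f∘g ρ) (f∘g (ρ + 1ℤ)) ⟨
      f m + (f (g ρ) - f (g (ρ + 1ℤ)))  ≡⟨ f-shift m (g (ρ + 1ℤ)) (g ρ) m≡β ⟨
      f (m + (g ρ - g (ρ + 1ℤ)))        ∎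
      where
      step : ∀ x → x - (x + 1ℤ) ≡ - 1ℤ
      step = solve-∀
    ...   | no m≢β = sAct-%ℕ-≢ₖ ρ (f m) (m≢α ∘ pull-back ρ) (m≢β ∘ pull-back (ρ + 1ℤ))
      where
      pull-back : ∀ z → f m ≡ₖ z → m ≡ₖ g z
      pull-back z fm≡z = subst (_≡ₖ g z) (g∘f m) (periodic-≡ₖ g g-periodic (f m) z fm≡z)

  module _ (k≥1 : 1 ≤ k) (vs : List ℕ) (ρ : ℤ) where

    private
      conjugation : ∀ m → sAct k (ρ %ℕ K) (wordAct k vs m)
        ≡ wordAct k vs (tAct k (wordAct k (reverse vs) ρ) (wordAct k (reverse vs) (ρ + 1ℤ)) m)
      conjugation = reflection-conjugate k≥1 (wordAct k vs) (wordAct k (reverse vs)) (wordAct-periodic vs) (wordAct-periodic (reverse vs))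
        (wordAct-reverse-inverseʳ k≥1 vs) (wordAct-reverse-inverseˡ k≥1 vs) ρ

    reverse-word-≢ₖ : ¬ wordAct k (reverse vs) ρ ≡ₖ wordAct k (reverse vs) (ρ + 1ℤ)
    reverse-word-≢ₖ = preimages-≢ₖ k≥1 (wordAct k vs) (wordAct k (reverse vs)) (wordAct-periodic vs) (wordAct-periodic (reverse vs))
      (wordAct-reverse-inverseʳ k≥1 vs) (wordAct-reverse-inverseˡ k≥1 vs) ρ

    wordAct-delete : ∀ us m → wordAct k (us ++ ρ %ℕ K ∷ vs) m
      ≡ wordAct k (us ++ vs) (tAct k (wordAct k (reverse vs) ρ) (wordAct k (reverse vs) (ρ + 1ℤ)) m)
    wordAct-delete us m = begin
      wordAct k (us ++ ρ %ℕ K ∷ vs) m                 ≡⟨ wordAct-++ us (ρ %ℕ K ∷ vs) m ⟩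
      wordAct k us (sAct k (ρ %ℕ K) (wordAct k vs m)) ≡⟨ cong (wordAct k us) (conjugation m) ⟩
      wordAct k us (wordAct k vs t[m])                ≡⟨ wordAct-++ us vs t[m] ⟨
      wordAct k (us ++ vs) t[m]                       ∎
      where
      t[m] : ℤ
      t[m] = tAct k (wordAct k (reverse vs) ρ) (wordAct k (reverse vs) (ρ + 1ℤ)) m

  actAlong : List Cell → ℤ → ℤ
  actAlong []       v = v
  actAlong (y ∷ ys) v = actAlong ys (sAct k (residue k y) v)

  actAlong-++ : ∀ xs ys v → actAlong (xs ++ ys) v ≡ actAlong ys (actAlong xs v)
  actAlong-++ []       ys v = refl
  actAlong-++ (x ∷ xs) ys v = actAlong-++ xs ys (sAct k (residue k x) v)

  wordAct-reverse≡actAlong : ∀ ys v → wordAct k (reverse (map (residue k) ys)) v ≡ actAlong ys v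
  wordAct-reverse≡actAlong []       v = refl
  wordAct-reverse≡actAlong (y ∷ ys) v = begin
    wordAct k (reverse (residue k y ∷ map (residue k) ys)) v
      ≡⟨ cong (λ l → wordAct k l v) (List.unfold-reverse (residue k y) (map (residue k) ys)) ⟩
    wordAct k (reverse (map (residue k) ys) ∷ʳ residue k y) v
      ≡⟨ wordAct-++ (reverse (map (residue k) ys)) (residue k y ∷ []) v ⟩
    wordAct k (reverse (map (residue k) ys)) (sAct k (residue k y) v)
      ≡⟨ wordAct-reverse≡actAlong ys (sAct k (residue k y) v) ⟩
    actAlong ys (sAct k (residue k y) v) ∎

  actAlong-fixed : ∀ {ys v} → All (λ y → sAct k (residue k y) v ≡ v) ys → actAlong ys v ≡ v
  actAlong-fixed []                = refl
  actAlong-fixed {y ∷ ys} (fix ∷ fixes) = trans (cong (actAlong ys) fix) (actAlong-fixed fixes)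

  actAlong-rowCells-skip : ∀ v p q d X → (∀ q′ → q < q′ → q′ ≤ d ℕ.+ q → sAct k (residue k (p , q′)) v ≡ v) →
    actAlong (rowCells p (d ℕ.+ q) X) v ≡ actAlong (rowCells p q X) v
  actAlong-rowCells-skip v p q zero    X fixes = refl
  actAlong-rowCells-skip v p q (suc d) X fixes with (p , suc (d ℕ.+ q)) ∈ᵇ X
  ... | true  = actAlong-rowCells-skip v p q d X (λ q′ q<q′ q′≤ → fixes q′ q<q′ (ℕ.m≤n⇒m≤1+n q′≤))
  ... | false = trans (cong (actAlong (rowCells p (d ℕ.+ q) X)) (fixes (suc (d ℕ.+ q)) (s≤s (ℕ.m≤n+m q d)) ℕ.≤-refl))
                      (actAlong-rowCells-skip v p q d X (λ q′ q<q′ q′≤ → fixes q′ q<q′ (ℕ.m≤n⇒m≤1+n q′≤)))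

-- Reading words

rowCells-All : ∀ {P : Cell → Set} p q X → (∀ q′ → 1 ≤ q′ → q′ ≤ q → P (p , q′)) → All P (rowCells p q X)
rowCells-All p zero    X row-P = []
rowCells-All p (suc q) X row-P with (p , suc q) ∈ᵇ X
... | true  = rowCells-All p q X (λ q′ 1≤q′ q′≤q → row-P q′ 1≤q′ (ℕ.m≤n⇒m≤1+n q′≤q))
... | false = row-P (suc q) (s≤s z≤n) ℕ.≤-refl ∷ rowCells-All p q X (λ q′ 1≤q′ q′≤q → row-P q′ 1≤q′ (ℕ.m≤n⇒m≤1+n q′≤q))

cellsFrom-All : ∀ {P : Cell → Set} la p X → (∀ p′ q′ → 1 ≤ p′ → p′ ≤ p → 1 ≤ q′ → q′ ≤ row la p′ → P (p′ , q′)) →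
  All P (cellsFrom la p X)
cellsFrom-All la zero    X cells-P = []
cellsFrom-All la (suc p) X cells-P = ++⁺
  (rowCells-All (suc p) (row la (suc p)) X (λ q′ → cells-P (suc p) q′ (s≤s z≤n) ℕ.≤-refl))
  (cellsFrom-All la p X (λ p′ q′ 1≤p′ p′≤p → cells-P p′ q′ 1≤p′ (ℕ.m≤n⇒m≤1+n p′≤p)))

-- the cells of λ ∖ X read after the cell (p + 1 , q + 1)
cellsAfter : List ℕ → List Cell → ℕ → ℕ → List Cell
cellsAfter la X p q = rowCells (suc p) q X ++ cellsFrom la p X

∈ᵇ-∷ʳ-≢ : ∀ Y x y → y ≢ x → y ∈ᵇ (Y ∷ʳ x) ≡ y ∈ᵇ Y
∈ᵇ-∷ʳ-≢ Y x y y≢x with y ∈? Y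
... | yes y∈Y = dec-true (y ∈? (Y ∷ʳ x)) (∈-++⁺ˡ y∈Y)
... | no  y∉Y = dec-false (y ∈? (Y ∷ʳ x)) ([ y∉Y , (λ { (here y≡x) → y≢x y≡x }) ]′ ∘ ∈-++⁻ Y)

rowCells-cong : ∀ p q {X Y} → (∀ q′ → q′ ≤ q → (p , q′) ∈ᵇ X ≡ (p , q′) ∈ᵇ Y) → rowCells p q X ≡ rowCells p q Y
rowCells-cong p zero    agree = refl
rowCells-cong p (suc q) {X} {Y} agree rewrite agree (suc q) ℕ.≤-refl =
  cong (λ r → if (p , suc q) ∈ᵇ Y then r else (p , suc q) ∷ r)
       (rowCells-cong p q (λ q′ q′≤q → agree q′ (ℕ.m≤n⇒m≤1+n q′≤q)))

cellsFrom-cong : ∀ la p {X Y} → (∀ p′ q′ → p′ ≤ p → (p′ , q′) ∈ᵇ X ≡ (p′ , q′) ∈ᵇ Y) →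
  cellsFrom la p X ≡ cellsFrom la p Y
cellsFrom-cong la zero    agree = refl
cellsFrom-cong la (suc p) agree = cong₂ _++_
  (rowCells-cong (suc p) (row la (suc p)) (λ q′ _ → agree (suc p) q′ ℕ.≤-refl))
  (cellsFrom-cong la p (λ p′ q′ p′≤p → agree p′ q′ (ℕ.m≤n⇒m≤1+n p′≤p)))

rowCells-common-prefix : ∀ p q d {X Y} →
  (∀ e → e < d → (p , suc (e ℕ.+ q)) ∈ᵇ X ≡ (p , suc (e ℕ.+ q)) ∈ᵇ Y) →
  ∃ λ P → rowCells p (d ℕ.+ q) X ≡ P ++ rowCells p q X × rowCells p (d ℕ.+ q) Y ≡ P ++ rowCells p q Y
rowCells-common-prefix p q zero    agree = [] , refl , refl
rowCells-common-prefix p q (suc d) {X} agree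
  with rowCells-common-prefix p q d (λ e e<d → agree e (ℕ.m<n⇒m<1+n e<d))
... | P , eqX , eqY rewrite sym (agree d ℕ.≤-refl) with (p , suc (d ℕ.+ q)) ∈ᵇ X
...   | true  = P , eqX , eqY
...   | false = (p , suc (d ℕ.+ q)) ∷ P , cong ((p , suc (d ℕ.+ q)) ∷_) eqX , cong ((p , suc (d ℕ.+ q)) ∷_) eqY

cellsFrom-common-prefix : ∀ la p d {X Y} →
  (∀ e q′ → e < d → (suc (e ℕ.+ p) , q′) ∈ᵇ X ≡ (suc (e ℕ.+ p) , q′) ∈ᵇ Y) →
  ∃ λ P → cellsFrom la (d ℕ.+ p) X ≡ P ++ cellsFrom la p X × cellsFrom la (d ℕ.+ p) Y ≡ P ++ cellsFrom la p Y
cellsFrom-common-prefix la p zero    agree = [] , refl , refl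
cellsFrom-common-prefix la p (suc d) {X} agree
  with cellsFrom-common-prefix la p d (λ e q′ e<d → agree e q′ (ℕ.m<n⇒m<1+n e<d))
... | P , eqX , eqY = R ++ P
  , trans (cong (R ++_) eqX) (sym (List.++-assoc R P _))
  , trans (cong₂ _++_ (sym (rowCells-cong n (row la n) (λ q′ _ → agree d q′ ℕ.≤-refl))) eqY) (sym (List.++-assoc R P _))
  where
  n : ℕ
  n = suc (d ℕ.+ p)
  R : List Cell
  R = rowCells n (row la n) X

reading-split : ∀ la Y i j → (suc i , suc j) ∉ Y → suc i ≤ length la → suc j ≤ row la (suc i) →
  let x = (suc i , suc j) in
  ∃ λ P → readingCells la Y ≡ P ++ x ∷ cellsAfter la (Y ∷ʳ x) i j
        × readingCells la (Y ∷ʳ x) ≡ P ++ cellsAfter la (Y ∷ʳ x) i j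
reading-split la Y i j x∉Y si≤len sj≤row
  with cellsFrom-common-prefix la (suc i) (length la ∸ suc i) {Y} {Y ∷ʳ (suc i , suc j)}
         (λ e q′ _ → sym (∈ᵇ-∷ʳ-≢ Y (suc i , suc j) (suc (e ℕ.+ suc i) , q′) (ℕ.m≢1+n+m (suc i) ∘ sym ∘ cong proj₁)))
     | rowCells-common-prefix (suc i) (suc j) (row la (suc i) ∸ suc j) {Y} {Y ∷ʳ (suc i , suc j)}
         (λ e _ → sym (∈ᵇ-∷ʳ-≢ Y (suc i , suc j) (suc i , suc (e ℕ.+ suc j)) (ℕ.m≢1+n+m (suc j) ∘ sym ∘ cong proj₂)))
... | Pc , rows-Y , rows-Y₊ | Pr , columns-Y , columns-Y₊ =
  Pc ++ Pr , split Y rows-Y columns-Y row-Y rest-Y , split Y₊ rows-Y₊ columns-Y₊ row-Y₊ refl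
  where
  x : Cell
  x = (suc i , suc j)
  Y₊ : List Cell
  Y₊ = Y ∷ʳ x

  off-x : ∀ {y} → y ≢ x → y ∈ᵇ Y ≡ y ∈ᵇ Y₊
  off-x {y} y≢x = sym (∈ᵇ-∷ʳ-≢ Y x y y≢x)

  row-Y : rowCells (suc i) (suc j) Y ≡ x ∷ rowCells (suc i) j Y₊
  row-Y = trans (cong (λ b → if b then rowCells (suc i) j Y else x ∷ rowCells (suc i) j Y) (dec-false (x ∈? Y) x∉Y))
                (cong (x ∷_) (rowCells-cong (suc i) j (λ q′ q′≤j → off-x (ℕ.<⇒≢ (s≤s q′≤j) ∘ cong proj₂))))

  rest-Y : cellsFrom la i Y ≡ cellsFrom la i Y₊
  rest-Y = cellsFrom-cong la i (λ p′ q′ p′≤i → off-x (ℕ.<⇒≢ (s≤s p′≤i) ∘ cong proj₁))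

  row-Y₊ : rowCells (suc i) (suc j) Y₊ ≡ rowCells (suc i) j Y₊
  row-Y₊ = cong (λ b → if b then rowCells (suc i) j Y₊ else x ∷ rowCells (suc i) j Y₊)
                (dec-true (x ∈? Y₊) (∈-++⁺ʳ Y (here refl)))

  split : ∀ {T} Z →
    cellsFrom la (length la ∸ suc i ℕ.+ suc i) Z ≡ Pc ++ cellsFrom la (suc i) Z →
    rowCells (suc i) (row la (suc i) ∸ suc j ℕ.+ suc j) Z ≡ Pr ++ rowCells (suc i) (suc j) Z →
    rowCells (suc i) (suc j) Z ≡ T → cellsFrom la i Z ≡ cellsFrom la i Y₊ →
    readingCells la Z ≡ (Pc ++ Pr) ++ T ++ cellsFrom la i Y₊
  split {T} Z rows-Z columns-Z row-Z rest-Z = begin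
    cellsFrom la (length la) Z
      ≡⟨ cong (λ n → cellsFrom la n Z) (ℕ.m∸n+n≡m si≤len) ⟨
    cellsFrom la (length la ∸ suc i ℕ.+ suc i) Z
      ≡⟨ rows-Z ⟩
    Pc ++ rowCells (suc i) (row la (suc i)) Z ++ cellsFrom la i Z
      ≡⟨ cong (λ n → Pc ++ rowCells (suc i) n Z ++ cellsFrom la i Z) (ℕ.m∸n+n≡m sj≤row) ⟨
    Pc ++ rowCells (suc i) (row la (suc i) ∸ suc j ℕ.+ suc j) Z ++ cellsFrom la i Z
      ≡⟨ cong (λ R → Pc ++ R ++ cellsFrom la i Z) columns-Z ⟩
    Pc ++ (Pr ++ rowCells (suc i) (suc j) Z) ++ cellsFrom la i Z
      ≡⟨ cong₂ (λ A B → Pc ++ (Pr ++ A) ++ B) row-Z rest-Z ⟩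
    Pc ++ (Pr ++ T) ++ cellsFrom la i Y₊
      ≡⟨ cong (Pc ++_) (List.++-assoc Pr T (cellsFrom la i Y₊)) ⟩
    Pc ++ Pr ++ T ++ cellsFrom la i Y₊
      ≡⟨ List.++-assoc Pc Pr (T ++ cellsFrom la i Y₊) ⟨
    (Pc ++ Pr) ++ T ++ cellsFrom la i Y₊ ∎

-- Contents in the rectangle

content-diagonal : ∀ p q → content (suc p , suc q) ≡ content (p , q)
content-diagonal p q = shift (+ p) (+ q)
  where
  shift : ∀ a b → (1ℤ + b) - (1ℤ + a) ≡ b - a
  shift = solve-∀

content-east : ∀ p q → content (p , suc q) ≡ content (p , q) + 1ℤ
content-east p q = shift (+ p) (+ q)
  where
  shift : ∀ a b → (1ℤ + b) - a ≡ (b - a) + 1ℤ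
  shift = solve-∀

content-north : ∀ p q → content (p , q) ≡ content (suc p , q) + 1ℤ
content-north p q = shift (+ p) (+ q)
  where
  shift : ∀ a b → b - a ≡ (b - (1ℤ + a)) + 1ℤ
  shift = solve-∀

content-≡⇒ : ∀ p q p′ q′ → content (p , q) ≡ content (p′ , q′) → q ℕ.+ p′ ≡ q′ ℕ.+ p
content-≡⇒ p q p′ q′ eq = ℤ.+-injective (begin
  + (q ℕ.+ p′)                      ≡⟨ ℤ.pos-+ q p′ ⟩
  + q + + p′                        ≡⟨ regroup (+ q) (+ p) (+ p′) ⟩
  (+ q - + p) + (+ p + + p′)        ≡⟨ cong (_+ (+ p + + p′)) eq ⟩
  (+ q′ - + p′) + (+ p + + p′)      ≡⟨ regroup′ (+ q′) (+ p) (+ p′) ⟩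
  + q′ + + p                        ≡⟨ ℤ.pos-+ q′ p ⟨
  + (q′ ℕ.+ p)                      ∎)
  where
  regroup : ∀ b a a′ → b + a′ ≡ (b - a) + (a + a′)
  regroup = solve-∀
  regroup′ : ∀ b a a′ → (b - a′) + (a + a′) ≡ b + a
  regroup′ = solve-∀

-- content (p , q) < content (p′ , q′), with both sides moved to avoid subtraction
ContentBelow : Cell → Cell → Set
ContentBelow (p , q) (p′ , q′) = q ℕ.+ p′ < q′ ℕ.+ p

ContentBelow⇒≢ : ∀ x y → ContentBelow x y → content x ≢ content y
ContentBelow⇒≢ (p , q) (p′ , q′) below eq = ℕ.<⇒≢ below (content-≡⇒ p q p′ q′ eq)

RemovalIdentity : ℕ → List ℕ → List Cell → Cell → Set
RemovalIdentity k la Y x =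
  (bounceWN (Y ∷ʳ x) x %ℕ suc k ≢ bounceNW (Y ∷ʳ x) x %ℕ suc k)
  × (∀ m → wAct k la Y m ≡ wAct k la (Y ∷ʳ x) (tAct k (bounceWN (Y ∷ʳ x) x) (bounceNW (Y ∷ʳ x) x) m))

module _ (k c : ℕ) (c≤k : c ≤ k) where

  private
    K h : ℕ
    K = suc k
    h = K ∸ c

  -- The rectangle R = (c^h) together with the row 0 above it.
  InR₀ : Cell → Set
  InR₀ (p , q) = p ≤ h × 1 ≤ q × q ≤ c

  content-window : ∀ p q → p ≤ h → suc q ≤ c →
    ∃ λ u → u < K × content (p , suc q) ≡ (1ℤ - + h) + + u
  content-window p q p≤h q<c = q ℕ.+ (h ∸ p) , u<K , (begin
    content (p , suc q)                       ≡⟨ shift (+ p) (+ (h ∸ p)) (+ q) ⟩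
    (1ℤ - (+ p + + (h ∸ p))) + (+ q + + (h ∸ p)) ≡⟨ cong₂ (λ a b → (1ℤ - a) + b) (ℤ.pos-+ p (h ∸ p)) (ℤ.pos-+ q (h ∸ p)) ⟨
    (1ℤ - + (p ℕ.+ (h ∸ p))) + + (q ℕ.+ (h ∸ p)) ≡⟨ cong (λ a → (1ℤ - + a) + + (q ℕ.+ (h ∸ p))) (ℕ.m+[n∸m]≡n p≤h) ⟩
    (1ℤ - + h) + + (q ℕ.+ (h ∸ p))            ∎)
    where
    shift : ∀ a d b → (1ℤ + b) - a ≡ (1ℤ - (a + d)) + (b + d)
    shift = solve-∀
    u<K : q ℕ.+ (h ∸ p) < K
    u<K = ℕ.<-≤-trans (ℕ.+-mono-<-≤ q<c (ℕ.m∸n≤m h p))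
                      (ℕ.≤-reflexive (ℕ.m+[n∸m]≡n (ℕ.≤-trans c≤k (ℕ.n≤1+n k))))

  content-≡ₖ⇒≡ : ∀ x y → InR₀ x → InR₀ y → _≡ₖ_ k (content x) (content y) → content x ≡ content y
  content-≡ₖ⇒≡ (p , suc q) (p′ , suc q′) (p≤h , _ , q≤c) (p′≤h , _ , q′≤c) eq
    with content-window p q p≤h q≤c | content-window p′ q′ p′≤h q′≤c
  ... | u , u<K , x≡ | u′ , u′<K , y≡ =
    trans x≡ (trans (cong (λ v → (1ℤ - + h) + + v) u≡u′) (sym y≡))
    where
    u≡u′ : u ≡ u′
    u≡u′ = window-injective k (1ℤ - + h) u<K u′<K (subst₂ (_≡ₖ_ k) x≡ y≡ eq)

  -- Residues determine contents on R₀, so s_{res y} moves only content y and content y + 1.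
  sAct-residue-fixes : ∀ v p q → InR₀ v → InR₀ (suc p , q) →
    ContentBelow v (suc p , q) ⊎ ContentBelow (p , q) v →
    sAct k (residue k (suc p , q)) (content v) ≡ content v
  sAct-residue-fixes v@(pᵥ , qᵥ) p q v∈R₀ (sp≤h , 1≤q , q≤c) far =
    sAct-%ℕ-≢ₖ k (content (suc p , q)) (content v)
      (v≢y ∘ content-≡ₖ⇒≡ v (suc p , q) v∈R₀ (sp≤h , 1≤q , q≤c))
      (v≢y′ ∘ content-≡ₖ⇒≡ v (p , q) v∈R₀ (ℕ.≤-trans (ℕ.n≤1+n p) sp≤h , 1≤q , q≤c)
             ∘ subst (_≡ₖ_ k (content v)) (sym (content-north p q)))
    where
    v≢y : content v ≢ content (suc p , q)
    v≢y = [ ContentBelow⇒≢ v (suc p , q)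
          , (λ below → ContentBelow⇒≢ (suc p , q) v
                         (subst (q ℕ.+ pᵥ <_) (sym (ℕ.+-suc qᵥ p)) (ℕ.m<n⇒m<1+n below)) ∘ sym) ]′ far
    v≢y′ : content v ≢ content (p , q)
    v≢y′ = [ (λ below → ContentBelow⇒≢ v (p , q) (ℕ.≤-<-trans (ℕ.+-monoʳ-≤ qᵥ (ℕ.n≤1+n p)) below))
           , (λ below → ContentBelow⇒≢ (p , q) v below ∘ sym) ]′ far

  module _ (k≥1 : 1 ≤ k) (la : List ℕ) (row≤c : ∀ p → row la p ≤ c)
           (rows-antitone : ∀ p → row la (suc (suc p)) ≤ row la (suc p)) where

    module _ (X : List Cell) where

      private
        after : ℕ → ℕ → List Cell
        after = cellsAfter la X

        track : List Cell → ℤ → ℤ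
        track = actAlong k

      actAlong-north-skip : ∀ p q → suc (suc p) ≤ h → suc q ≤ row la (suc (suc p)) →
        track (after (suc p) q) (content (suc p , suc q))
          ≡ track (rowCells (suc p) (suc q) X ++ cellsFrom la p X) (content (suc p , suc q))
      actAlong-north-skip p q ssp≤h sq≤row = begin
        track (R₂ ++ R₁ ++ C) v          ≡⟨ actAlong-++ k R₂ (R₁ ++ C) v ⟩
        track (R₁ ++ C) (track R₂ v)     ≡⟨ cong (track (R₁ ++ C)) (actAlong-fixed k (rowCells-All (suc (suc p)) q X left-fixes)) ⟩
        track (R₁ ++ C) v                ≡⟨ actAlong-++ k R₁ C v ⟩
        track C (track R₁ v)             ≡⟨ cong (λ n → track C (track (rowCells (suc p) n X) v)) (ℕ.m∸n+n≡m sq≤row′) ⟨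
        track C (track (rowCells (suc p) (row la (suc p) ∸ suc q ℕ.+ suc q) X) v)
                                         ≡⟨ cong (track C) (actAlong-rowCells-skip k v (suc p) (suc q) _ X right-fixes) ⟩
        track C (track (rowCells (suc p) (suc q) X) v) ≡⟨ actAlong-++ k (rowCells (suc p) (suc q) X) C v ⟨
        track (rowCells (suc p) (suc q) X ++ C) v ∎
        where
        v : ℤ
        v = content (suc p , suc q)
        R₂ R₁ C : List Cell
        R₂ = rowCells (suc (suc p)) q X
        R₁ = rowCells (suc p) (row la (suc p)) X
        C = cellsFrom la p X
        sq≤row′ : suc q ≤ row la (suc p)
        sq≤row′ = ℕ.≤-trans sq≤row (rows-antitone p)
        sq≤c : suc q ≤ c
        sq≤c = ℕ.≤-trans sq≤row (row≤c (suc (suc p)))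
        sp≤h : suc p ≤ h
        sp≤h = ℕ.≤-trans (ℕ.n≤1+n (suc p)) ssp≤h
        v∈R₀ : InR₀ (suc p , suc q)
        v∈R₀ = sp≤h , s≤s z≤n , sq≤c
        left-fixes : ∀ q′ → 1 ≤ q′ → q′ ≤ q → sAct k (residue k (suc (suc p) , q′)) v ≡ v
        left-fixes q′ 1≤q′ q′≤q = sAct-residue-fixes (suc p , suc q) (suc p) q′ v∈R₀
          (ssp≤h , 1≤q′ , ℕ.≤-trans (ℕ.m≤n⇒m≤1+n q′≤q) sq≤c) (inj₂ (ℕ.+-monoˡ-< (suc p) (s≤s q′≤q)))
        right-fixes : ∀ q′ → suc q < q′ → q′ ≤ row la (suc p) ∸ suc q ℕ.+ suc q → sAct k (residue k (suc p , q′)) v ≡ v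
        right-fixes q′ sq<q′ q′≤ = sAct-residue-fixes (suc p , suc q) p q′ v∈R₀
          (sp≤h , ℕ.≤-trans (s≤s z≤n) sq<q′ ,
           ℕ.≤-trans q′≤ (ℕ.≤-trans (ℕ.≤-reflexive (ℕ.m∸n+n≡m sq≤row′)) (row≤c (suc p))))
          (inj₁ (ℕ.+-monoˡ-< (suc p) sq<q′))

      -- Heading West at a cell the tracked value is its content,
      -- heading North it is the content of the cell above it.
      mutual
        actAlong-west : ∀ p q → suc p ≤ h → suc q ≤ row la (suc p) →
          track (after p q) (content (suc p , suc q)) ≡ bounce X west (suc p) (suc q)
        actAlong-west p zero sp≤h 1≤row = actAlong-fixed k (cellsFrom-All la p X above-fixes)
          where
          above-fixes : ∀ p′ q′ → 1 ≤ p′ → p′ ≤ p → 1 ≤ q′ → q′ ≤ row la p′ →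
            sAct k (residue k (p′ , q′)) (content (suc p , 1)) ≡ content (suc p , 1)
          above-fixes (suc p′) q′ _ sp′≤p 1≤q′ q′≤row = sAct-residue-fixes (suc p , 1) p′ q′
            (sp≤h , s≤s z≤n , ℕ.≤-trans 1≤row (row≤c (suc p)))
            (ℕ.≤-trans (ℕ.m≤n⇒m≤1+n sp′≤p) sp≤h , 1≤q′ , ℕ.≤-trans q′≤row (row≤c (suc p′)))
            (inj₁ (ℕ.≤-trans (s≤s (s≤s sp′≤p)) (ℕ.+-monoˡ-≤ (suc p) 1≤q′)))
        actAlong-west p (suc q) sp≤h ssq≤row with (suc p , suc q) ∈ᵇ X
        ... | true  = trans (cong (track (after p q)) (content-diagonal p (suc q)))
                            (actAlong-north p q sp≤h (ℕ.≤-trans (ℕ.n≤1+n (suc q)) ssq≤row))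
        ... | false = trans (cong (track (after p q)) moves-west)
                            (actAlong-west p q sp≤h (ℕ.≤-trans (ℕ.n≤1+n (suc q)) ssq≤row))
          where
          moves-west : sAct k (residue k (suc p , suc q)) (content (suc p , suc (suc q))) ≡ content (suc p , suc q)
          moves-west = begin
            sAct k (residue k (suc p , suc q)) (content (suc p , suc (suc q)))
              ≡⟨ sAct-%ℕ-≡ₖ-+1 k k≥1 (content (suc p , suc q)) (content (suc p , suc (suc q)))
                   (cong (_%ℕ suc k) (content-east (suc p) (suc q))) ⟩
            content (suc p , suc (suc q)) - 1ℤ
              ≡⟨ cong (_- 1ℤ) (content-east (suc p) (suc q)) ⟩
            content (suc p , suc q) + 1ℤ - 1ℤ
              ≡⟨ cancel (content (suc p , suc q)) ⟩
            content (suc p , suc q) ∎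
            where
            cancel : ∀ x → x + 1ℤ - 1ℤ ≡ x
            cancel = solve-∀

        actAlong-north : ∀ p q → suc p ≤ h → suc q ≤ row la (suc p) →
          track (after p q) (content (p , suc q)) ≡ bounce X north (suc p) (suc q)
        actAlong-north zero q 1≤h sq≤row = trans (actAlong-++ k (rowCells 1 q X) [] _)
          (actAlong-fixed k (rowCells-All 1 q X left-fixes))
          where
          left-fixes : ∀ q′ → 1 ≤ q′ → q′ ≤ q → sAct k (residue k (1 , q′)) (content (0 , suc q)) ≡ content (0 , suc q)
          left-fixes q′ 1≤q′ q′≤q = sAct-residue-fixes (0 , suc q) 0 q′
            (z≤n , s≤s z≤n , ℕ.≤-trans sq≤row (row≤c 1))
            (1≤h , 1≤q′ , ℕ.≤-trans (ℕ.m≤n⇒m≤1+n q′≤q) (ℕ.≤-trans sq≤row (row≤c 1)))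
            (inj₂ (ℕ.+-monoˡ-< 0 (s≤s q′≤q)))
        actAlong-north (suc p) q ssp≤h sq≤row =
          trans (actAlong-north-skip p q ssp≤h sq≤row)
                (actAlong-north-turn p q (ℕ.≤-trans (ℕ.n≤1+n (suc p)) ssp≤h) (ℕ.≤-trans sq≤row (rows-antitone p)))

        actAlong-north-turn : ∀ p q → suc p ≤ h → suc q ≤ row la (suc p) →
          track (rowCells (suc p) (suc q) X ++ cellsFrom la p X) (content (suc p , suc q))
            ≡ bounce X north (suc (suc p)) (suc q)
        actAlong-north-turn p q sp≤h sq≤row with (suc p , suc q) ∈ᵇ X
        ... | true  = actAlong-west p q sp≤h sq≤row
        ... | false = trans (cong (track (after p q)) moves-north) (actAlong-north p q sp≤h sq≤row)
          where
          moves-north : sAct k (residue k (suc p , suc q)) (content (suc p , suc q)) ≡ content (p , suc q)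
          moves-north = trans (sAct-%ℕ-≡ₖ k (content (suc p , suc q)) (content (suc p , suc q)) refl) (sym (content-north p (suc q)))

    wAct-remove-cell : length la ≤ h → ∀ Y x → x ∉ Y → x ∈λ la → RemovalIdentity k la Y x
    wAct-remove-cell len≤h Y (zero  , _)     _ (() , _)
    wAct-remove-cell len≤h Y (suc i , zero)  _ (_ , _ , () , _)
    wAct-remove-cell len≤h Y (suc i , suc j) x∉Y (_ , si≤len , _ , sj≤row)
      with reading-split la Y i j x∉Y si≤len sj≤row
    ... | P , read-Y , read-Y₊ =
      subst₂ (λ a b → a %ℕ K ≢ b %ℕ K) α≡ β≡ (reverse-word-≢ₖ k k≥1 (map res S) ρ) , λ m → begin
        wordAct k (map res (readingCells la Y)) m
          ≡⟨ cong (λ l → wordAct k (map res l) m) read-Y ⟩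
        wordAct k (map res (P ++ x ∷ S)) m
          ≡⟨ cong (λ l → wordAct k l m) (List.map-++ res P (x ∷ S)) ⟩
        wordAct k (map res P ++ ρ %ℕ K ∷ map res S) m
          ≡⟨ wordAct-delete k k≥1 (map res S) ρ (map res P) m ⟩
        wordAct k (map res P ++ map res S) (tAct k α β m)
          ≡⟨ cong₂ (λ l t → wordAct k l t) (sym (List.map-++ res P S)) (cong₂ (λ a b → tAct k a b m) α≡ β≡) ⟩
        wordAct k (map res (P ++ S)) (tAct k (bounceWN Y₊ x) (bounceNW Y₊ x) m)
          ≡⟨ cong (λ l → wordAct k (map res l) (tAct k (bounceWN Y₊ x) (bounceNW Y₊ x) m)) read-Y₊ ⟨
        wordAct k (map res (readingCells la Y₊)) (tAct k (bounceWN Y₊ x) (bounceNW Y₊ x) m) ∎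
      where
      x : Cell
      x = (suc i , suc j)
      Y₊ S : List Cell
      Y₊ = Y ∷ʳ x
      S = cellsAfter la Y₊ i j
      res : Cell → ℕ
      res = residue k
      ρ α β : ℤ
      ρ = content x
      α = wordAct k (reverse (map res S)) ρ
      β = wordAct k (reverse (map res S)) (ρ + 1ℤ)
      si≤h : suc i ≤ h
      si≤h = ℕ.≤-trans si≤len len≤h
      α≡ : α ≡ bounceWN Y₊ x
      α≡ = trans (wordAct-reverse≡actAlong k S ρ) (actAlong-west Y₊ i j si≤h sj≤row)
      β≡ : β ≡ bounceNW Y₊ x
      β≡ = begin
        β                                ≡⟨ wordAct-reverse≡actAlong k S (ρ + 1ℤ) ⟩
        actAlong k S (ρ + 1ℤ)            ≡⟨ cong (actAlong k S) (content-north i (suc j)) ⟨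
        actAlong k S (content (i , suc j)) ≡⟨ actAlong-north Y₊ i j si≤h sj≤row ⟩
        bounceNW Y₊ x                    ∎

row-bounded : ∀ {c} la → All (_≤ c) la → ∀ p → row la p ≤ c
row-bounded []       _              p             = z≤n
row-bounded (r ∷ la) _              zero          = z≤n
row-bounded (r ∷ la) (r≤c ∷ _)      (suc zero)    = r≤c
row-bounded (r ∷ la) (_ ∷ rows≤c)   (suc (suc p)) = row-bounded la rows≤c (suc p)

row-antitone : ∀ la → Linked ℕ._≥_ la → ∀ p → row la (suc (suc p)) ≤ row la (suc p)
row-antitone []             _               p       = z≤n
row-antitone (r ∷ [])       _               p       = z≤n
row-antitone (r ∷ r′ ∷ la)  (r≥r′ ∷ _)      zero    = r≥r′
row-antitone (r ∷ r′ ∷ la)  (_ ∷ linked)    (suc p) = row-antitone (r′ ∷ la) linked p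

lookup∉take : ∀ {A : Set} (xs : List A) i → Unique xs → lookup xs i ∉ take (toℕ i) xs
lookup∉take (x ∷ xs) (suc i) (x∉xs ∷ _) (here eq)  = All.lookup x∉xs (∈-lookup i) (sym eq)
lookup∉take (x ∷ xs) (suc i) (_ ∷ unique) (there m) = lookup∉take xs i unique m

bounce-west-clear : ∀ X p q → (∀ q′ → q′ ≤ q → (p , q′) ∈ᵇ X ≡ false) → bounce X west p (suc q) ≡ content (p , 1)
bounce-west-clear X p zero    clear = refl
bounce-west-clear X p (suc q) clear rewrite clear (suc q) ℕ.≤-refl =
  bounce-west-clear X p q (λ q′ q′≤q → clear q′ (ℕ.m≤n⇒m≤1+n q′≤q))

bounce-north-clear : ∀ X p q → (∀ p′ → p′ ≤ p → (p′ , q) ∈ᵇ X ≡ false) → bounce X north (suc p) q ≡ content (0 , q)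
bounce-north-clear X zero    q clear = refl
bounce-north-clear X (suc p) q clear rewrite clear (suc p) ℕ.≤-refl =
  bounce-north-clear X p q (λ p′ p′≤p → clear p′ (ℕ.m≤n⇒m≤1+n p′≤p))

proposition4p10 : (k c : ℕ) → 1 ≤ k → c ≤ k →
    (la : List ℕ) → IsPartition la → InRect c (suc k ∸ c) la →
    ((xs : List Cell) → Unique xs → All (λ x → x ∈λ la) xs →
      (i : Fin (length xs)) →
        (bounceWN (take (suc (toℕ i)) xs) (lookup xs i) %ℕ suc k)
          ≢ (bounceNW (take (suc (toℕ i)) xs) (lookup xs i) %ℕ suc k)
        × ((m : ℤ) → wAct k la (take (toℕ i) xs) m
            ≡ wAct k la (take (suc (toℕ i)) xs)
                (tAct k (bounceWN (take (suc (toℕ i)) xs) (lookup xs i))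
                        (bounceNW (take (suc (toℕ i)) xs) (lookup xs i)) m)))
    × ((p q : ℕ) → (p , q) ∈λ la →
        (m : ℤ) → wAct k la [] m
          ≡ wAct k la ((p , q) ∷ []) (tAct k (+ 1 - + p) (+ q) m))
proposition4p10 k c k≥1 c≤k la (decreasing , _) (len≤h , rows≤c) = remove-lookup , remove-single
  where
  remove : ∀ Y x → x ∉ Y → x ∈λ la → RemovalIdentity k la Y x
  remove = wAct-remove-cell k c c≤k k≥1 la (row-bounded la rows≤c) (row-antitone la decreasing) len≤h

  remove-lookup : ∀ xs → Unique xs → All (_∈λ la) xs → ∀ i →
    let Xᵢ = take (suc (toℕ i)) xs ; xᵢ = lookup xs i in
    (bounceWN Xᵢ xᵢ %ℕ suc k ≢ bounceNW Xᵢ xᵢ %ℕ suc k)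
    × (∀ m → wAct k la (take (toℕ i) xs) m ≡ wAct k la Xᵢ (tAct k (bounceWN Xᵢ xᵢ) (bounceNW Xᵢ xᵢ) m))
  remove-lookup xs unique cells i rewrite List.take-suc xs i =
    remove (take (toℕ i) xs) (lookup xs i) (lookup∉take xs i unique) (All.lookup cells (∈-lookup i))

  remove-single : ∀ p q → (p , q) ∈λ la → ∀ m → wAct k la [] m ≡ wAct k la ((p , q) ∷ []) (tAct k (+ 1 - + p) (+ q) m)
  remove-single zero    q       (() , _)
  remove-single (suc i) zero    (_ , _ , () , _)
  remove-single (suc i) (suc j) x∈la m = trans (proj₂ (remove [] x (λ ()) x∈la) m)
    (cong₂ (λ a b → wAct k la (x ∷ []) (tAct k a b m)) west-end (trans north-end (ℤ.+-identityʳ (+ suc j))))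
    where
    x : Cell
    x = (suc i , suc j)
    west-end : bounceWN (x ∷ []) x ≡ content (suc i , 1)
    west-end = bounce-west-clear (x ∷ []) (suc i) j
      (λ q′ q′≤j → ∈ᵇ-∷ʳ-≢ [] x (suc i , q′) (ℕ.<⇒≢ (s≤s q′≤j) ∘ cong proj₂))
    north-end : bounceNW (x ∷ []) x ≡ content (0 , suc j)
    north-end = bounce-north-clear (x ∷ []) i (suc j)
      (λ p′ p′≤i → ∈ᵇ-∷ʳ-≢ [] x (p′ , suc j) (ℕ.<⇒≢ (s≤s p′≤i) ∘ cong proj₁))
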